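{- Let $t\ge 2$. Let $G$ be a graph on $[n]$ that contains neither $M^2_t$ nor $K^2_{2t-1}$ as a subgraph, and let $i,j\in[n]$ be distinct. Then $\pi_{ij}(G)$ does not contain $K^2_{2t-1}$.
   Context: $M^2_t$ is a matching of $t$ disjoint edges; $K^2_p$ is the complete graph on $p$ vertices. For a graph ($2$-graph) $G$ on $[n]$ and distinct $i,j$, let $L_G(j\setminus i)=\{v\in[n]\setminus\{i,j\}: vj\in E(G),\ vi\notin E(G)\}$, and define $\pi_{ij}(G)$ as the graph on $[n]$ with edge set $\big(E(G)\setminus\{vj: v\in L_G(j\setminus i)\}\big)\cup\{vi: v\in L_G(j\setminus i)\}$. -}

module Defs where

open import Data.Nat using (ℕ; _*_; _/_)
open import Data.Bool using (Bool; true; false; _∧_; _∨_; not)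
open import Data.Fin using (Fin; toℕ)
open import Data.Fin.Properties using (_≟_)
open import Relation.Nullary.Decidable using (⌊_⌋)
open import Relation.Binary.PropositionalEquality using (_≡_)
open import Function.Definitions using (Injective)

Graph : ℕ → Set
Graph n = Fin n → Fin n → Bool

record IsSimple {n : ℕ} (G : Graph n) : Set where
  field
    sym    : ∀ u v → G u v ≡ G v u
    irrefl : ∀ u → G u u ≡ false

_⊆G_ : {m n : ℕ} → Graph m → Graph n → Set
_⊆G_ {m} {n} H G =
  Σ' (Fin m → Fin n) λ φ → Injective _≡_ _≡_ φ × (∀ u v → H u v ≡ true → G (φ u) (φ v) ≡ true)
  where
  open import Data.Product using (_×_) renaming (Σ to Σ')

K : (p : ℕ) → Graph p
K p u v = not ⌊ u ≟ v ⌋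

-- Matching M_t of t disjoint edges on Fin (2t): edges {2k, 2k+1}.
M : (t : ℕ) → Graph (2 * t)
M t u v = not ⌊ u ≟ v ⌋ ∧ ⌊ toℕ u / 2 Data.Nat.≟ toℕ v / 2 ⌋
  where import Data.Nat

L : {n : ℕ} → Graph n → Fin n → Fin n → Fin n → Bool
L G i j v = not ⌊ v ≟ i ⌋ ∧ not ⌊ v ≟ j ⌋ ∧ G v j ∧ not (G v i)

-- The shift π_ij(G): remove edges vj with v ∈ L_G(j\i), add edges vi for such v.
π : {n : ℕ} → Fin n → Fin n → Graph n → Graph n
π i j G x y =
  (G x y ∧ not (⌊ x ≟ j ⌋ ∧ L G i j y) ∧ not (⌊ y ≟ j ⌋ ∧ L G i j x))
  ∨ (⌊ x ≟ i ⌋ ∧ L G i j y) ∨ (⌊ y ≟ i ⌋ ∧ L G i j x)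

-- The shift only adds edges at i, so a clique of π_ij(G) avoiding i is already
-- a clique of G. If the clique uses i, the remaining vertices are either
-- all G-adjacent to i (the clique lies in G), or some w was moved onto i, so that
-- w ∈ L(j∖i): then w j ∈ E(G), j lies outside the clique (w j was deleted), and
-- either j can replace i in the clique, or some u of the clique misses j and
-- therefore was already adjacent to i in G. In the last case w j, u i and a
-- perfect matching of the remaining 2t − 4 clique vertices form an M_t in G.
module Submission where

open import Defs
open import Data.Nat using (ℕ; _≤_; _*_; _∸_)
open import Data.Fin using (Fin)
open import Relation.Nullary using (¬_)
open import Relation.Binary.PropositionalEquality using (_≡_)

open import Data.Nat using (suc; s≤s; z≤n; _+_)
import Data.Nat as ℕ
open import Data.Nat.Properties using (*-distribˡ-+)
import Data.Nat.Properties as ℕ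
open import Data.Nat.DivMod using (_/_; m/n≡1+[m∸n]/n)
open import Data.Fin using (zero; suc; toℕ; punchIn; punchOut)
open import Data.Fin.Properties
  using (_≟_; any?; all?; ¬∀⟶∃¬; punchIn-injective; punchInᵢ≢i; punchIn-punchOut)
open import Data.Vec.Functional using (_∷_)
open import Data.Bool using (true; false; _∧_; _∨_; not)
import Data.Bool.Properties as Bool
open import Data.Product using (Σ; _×_; _,_; proj₁; proj₂)
open import Data.Sum using (_⊎_; inj₁; inj₂; [_,_]′)
open import Function using (_∘_)
open import Function.Definitions using (Injective)
import Function.Construct.Composition as Compose
open import Relation.Nullary using (Dec; yes; no; contradiction)
open import Relation.Nullary.Decidable using (⌊_⌋; isYes≗does; dec-true; dec-false)
open import Relation.Binary.PropositionalEquality using (_≢_; refl; sym; trans; cong; subst)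

private
  variable
    m n q : ℕ

∨-true : ∀ a {b} → a ∨ b ≡ true → a ≡ true ⊎ b ≡ true
∨-true true  _ = inj₁ refl
∨-true false h = inj₂ h

∧-true : ∀ a {b} → a ∧ b ≡ true → a ≡ true × b ≡ true
∧-true true h = refl , h

not-∧-true : ∀ {a b} → not (a ∧ b) ≡ true → a ≡ true → b ≢ true
not-∧-true () refl refl

from-⌊⌋ : ∀ {P : Set} (P? : Dec P) → ⌊ P? ⌋ ≡ true → P
from-⌊⌋ (yes p) _ = p

from-not⌊⌋ : ∀ {P : Set} (P? : Dec P) → not ⌊ P? ⌋ ≡ true → ¬ P
from-not⌊⌋ (no ¬p) _ = ¬p

⌊⌋-true : ∀ {P : Set} (P? : Dec P) → P → ⌊ P? ⌋ ≡ true
⌊⌋-true P? p = trans (isYes≗does P?) (dec-true P? p)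

⌊⌋-false : ∀ {P : Set} (P? : Dec P) → ¬ P → ⌊ P? ⌋ ≡ false
⌊⌋-false P? ¬p = trans (isYes≗does P?) (dec-false P? ¬p)

_∉Im_ : Fin n → (Fin m → Fin n) → Set
v ∉Im f = ∀ k → f k ≢ v

record IsClique (G : Graph n) (f : Fin m → Fin n) : Set where
  constructor isClique
  field
    injective : Injective _≡_ _≡_ f
    adjacent  : ∀ u v → u ≢ v → G (f u) (f v) ≡ true

Paired : Fin m → Fin m → Set
Paired u v = u ≢ v × toℕ u / 2 ≡ toℕ v / 2

record IsMatching (G : Graph n) (f : Fin m → Fin n) : Set where
  constructor isMatching
  field
    injective : Injective _≡_ _≡_ f
    adjacent  : ∀ u v → Paired u v → G (f u) (f v) ≡ true

HasClique : Graph n → ℕ → Set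
HasClique {n} G m = Σ (Fin m → Fin n) (IsClique G)

HasMatching : Graph n → ℕ → Set
HasMatching {n} G m = Σ (Fin m → Fin n) (IsMatching G)

K⊆G⇒HasClique : ∀ m {G : Graph n} → K m ⊆G G → HasClique G m
K⊆G⇒HasClique m (f , f-inj , edges) =
  f , isClique f-inj λ u v u≢v → edges u v (cong not (⌊⌋-false (u ≟ v) u≢v))

HasClique⇒K⊆G : ∀ m {G : Graph n} → HasClique G m → K m ⊆G G
HasClique⇒K⊆G m (f , isClique f-inj edges) =
  f , f-inj , λ u v Kuv → edges u v (from-not⌊⌋ (u ≟ v) Kuv)

HasMatching⇒M⊆G : ∀ t {G : Graph n} → HasMatching G (2 * t) → M t ⊆G G
HasMatching⇒M⊆G t (f , isMatching f-inj edges) = f , f-inj , λ u v Muv →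
  let u≢v , same-pair = ∧-true _ Muv
  in edges u v (from-not⌊⌋ (u ≟ v) u≢v , from-⌊⌋ (toℕ u / 2 ℕ.≟ toℕ v / 2) same-pair)

∷-injective : ∀ {v} {f : Fin m → Fin n} → v ∉Im f → Injective _≡_ _≡_ f →
              Injective _≡_ _≡_ (v ∷ f)
∷-injective v∉f f-inj {zero}  {zero}  _  = refl
∷-injective v∉f f-inj {zero}  {suc l} eq = contradiction (sym eq) (v∉f l)
∷-injective v∉f f-inj {suc k} {zero}  eq = contradiction eq (v∉f k)
∷-injective v∉f f-inj {suc k} {suc l} eq = cong suc (f-inj eq)

∉Im-∷ : ∀ {u v} {f : Fin m → Fin n} → u ≢ v → v ∉Im f → v ∉Im (u ∷ f)
∉Im-∷ u≢v v∉f zero    = u≢v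
∉Im-∷ u≢v v∉f (suc k) = v∉f k

∉Im-punchIn : ∀ {f : Fin (suc m) → Fin n} → Injective _≡_ _≡_ f →
              ∀ x → f x ∉Im (f ∘ punchIn x)
∉Im-punchIn f-inj x k = punchInᵢ≢i x k ∘ f-inj

IsClique-∘ : ∀ {G : Graph n} {f : Fin m → Fin n} {g : Fin q → Fin m} →
             IsClique G f → Injective _≡_ _≡_ g → IsClique G (f ∘ g)
IsClique-∘ {g = g} (isClique f-inj edges) g-inj =
  isClique (Compose.injective _≡_ _≡_ _≡_ g-inj f-inj) λ u v u≢v → edges (g u) (g v) (u≢v ∘ g-inj)

IsClique-∷ : ∀ {G : Graph n} {f : Fin m → Fin n} {v} → IsSimple G →
             IsClique G f → v ∉Im f → (∀ k → G (f k) v ≡ true) → IsClique G (v ∷ f)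
IsClique-∷ {G = G} {f} {v} simple (isClique f-inj edges) v∉f f~v =
  isClique (∷-injective v∉f f-inj) edges′
  where
  edges′ : ∀ u w → u ≢ w → G ((v ∷ f) u) ((v ∷ f) w) ≡ true
  edges′ zero    zero    0≢0 = contradiction refl 0≢0
  edges′ zero    (suc l) _   = trans (IsSimple.sym simple v (f l)) (f~v l)
  edges′ (suc k) zero    _   = f~v k
  edges′ (suc k) (suc l) k≢l = edges k l (k≢l ∘ cong suc)

IsClique⇒IsMatching : ∀ {G : Graph n} {f : Fin m → Fin n} → IsClique G f → IsMatching G f
IsClique⇒IsMatching (isClique f-inj edges) = isMatching f-inj λ u v (u≢v , _) → edges u v u≢v

half-2+ : ∀ k → (2 + k) / 2 ≡ suc (k / 2)
half-2+ k = m/n≡1+[m∸n]/n {2 + k} (s≤s (s≤s z≤n))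

IsMatching-∷∷ : ∀ {G : Graph n} {f : Fin m → Fin n} {x y} → IsSimple G →
                G x y ≡ true → x ≢ y → x ∉Im f → y ∉Im f →
                IsMatching G f → IsMatching G (x ∷ y ∷ f)
IsMatching-∷∷ {G = G} {f} {x} {y} simple xy x≢y x∉f y∉f (isMatching f-inj edges) =
  isMatching (∷-injective (∉Im-∷ (x≢y ∘ sym) x∉f) (∷-injective y∉f f-inj)) edges′
  where
  pair-index-2+≢0 : ∀ k → toℕ (suc (suc k)) / 2 ≢ 0
  pair-index-2+≢0 k eq = ℕ.1+n≢0 (trans (sym (half-2+ (toℕ k))) eq)

  edges′ : ∀ u v → Paired u v → G ((x ∷ y ∷ f) u) ((x ∷ y ∷ f) v) ≡ true
  edges′ zero             zero             (u≢v , _)  = contradiction refl u≢v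
  edges′ (suc zero)       (suc zero)       (u≢v , _)  = contradiction refl u≢v
  edges′ zero             (suc zero)       _          = xy
  edges′ (suc zero)       zero             _          = trans (IsSimple.sym simple y x) xy
  edges′ zero             (suc (suc l))    (_ , same) = contradiction (sym same) (pair-index-2+≢0 l)
  edges′ (suc zero)       (suc (suc l))    (_ , same) = contradiction (sym same) (pair-index-2+≢0 l)
  edges′ (suc (suc k))    zero             (_ , same) = contradiction same (pair-index-2+≢0 k)
  edges′ (suc (suc k))    (suc zero)       (_ , same) = contradiction same (pair-index-2+≢0 k)
  edges′ (suc (suc k))    (suc (suc l))    (u≢v , same) =
    edges k l ( (λ { refl → u≢v refl })
              , ℕ.suc-injective (trans (sym (half-2+ (toℕ k))) (trans same (half-2+ (toℕ l)))))

clique+two-pendant-edges⇒matching :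
  ∀ {G : Graph n} {f : Fin (2 + q) → Fin n} {w u x y} → IsSimple G →
  IsClique G f → w ≢ u → x ≢ y → x ∉Im f → y ∉Im f →
  G (f w) x ≡ true → G (f u) y ≡ true → HasMatching G (4 + q)
clique+two-pendant-edges⇒matching {q = q} {f = f} {w} {u} {x} {y}
  simple f-clique@(isClique f-inj _) w≢u x≢y x∉f y∉f wx uy =
  f w ∷ x ∷ f u ∷ y ∷ rest ,
  IsMatching-∷∷ simple wx (x∉f w)
    (∉Im-∷ (fw≢fu ∘ sym) (∉Im-∷ (y∉f w ∘ sym) fw∉rest))
    (∉Im-∷ (x∉f u) (∉Im-∷ (x≢y ∘ sym) (x∉f ∘ skip)))
    (IsMatching-∷∷ simple uy (y∉f u) fu∉rest (y∉f ∘ skip)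
       (IsClique⇒IsMatching (IsClique-∘ f-clique skip-injective)))
  where
  u′ = punchOut w≢u
  skip : Fin q → Fin (2 + q)
  skip = punchIn w ∘ punchIn u′
  skip-injective : Injective _≡_ _≡_ skip
  skip-injective = Compose.injective _≡_ _≡_ _≡_ (punchIn-injective u′ _ _) (punchIn-injective w _ _)
  rest = f ∘ skip
  fw≢fu : f w ≢ f u
  fw≢fu = w≢u ∘ f-inj
  fw∉rest : f w ∉Im rest
  fw∉rest k = ∉Im-punchIn f-inj w (punchIn u′ k)
  fu∉rest : f u ∉Im rest
  fu∉rest k = subst (λ z → rest k ≢ f z) (punchIn-punchOut w≢u)
                (∉Im-punchIn (Compose.injective _≡_ _≡_ _≡_ (punchIn-injective w _ _) f-inj) u′ k)

module Shift {G : Graph n} {i j : Fin n} where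

  InL : Fin n → Set
  InL x = L G i j x ≡ true

  InL⇒ : ∀ {x} → InL x → x ≢ i × x ≢ j × G x j ≡ true
  InL⇒ {x} Lx =
    let x≢i , Lx₁ = ∧-true (not ⌊ x ≟ i ⌋) Lx
        x≢j , Lx₂ = ∧-true (not ⌊ x ≟ j ⌋) Lx₁
    in from-not⌊⌋ (x ≟ i) x≢i , from-not⌊⌋ (x ≟ j) x≢j , proj₁ (∧-true (G x j) Lx₂)

  InL⇒≢i : ∀ {x} → InL x → x ≢ i
  InL⇒≢i = proj₁ ∘ InL⇒

  InL⇒≢j : ∀ {x} → InL x → x ≢ j
  InL⇒≢j = proj₁ ∘ proj₂ ∘ InL⇒

  InL⇒adjacent-j : ∀ {x} → InL x → G x j ≡ true
  InL⇒adjacent-j = proj₂ ∘ proj₂ ∘ InL⇒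

  π-edge-cases : ∀ {x y} → π i j G x y ≡ true →
    (G x y ≡ true × ¬ (x ≡ j × InL y) × ¬ (y ≡ j × InL x)) ⊎
    (x ≡ i × InL y) ⊎ (y ≡ i × InL x)
  π-edge-cases {x} {y} h with ∨-true _ h
  ... | inj₁ kept =
    let xy , not-moved  = ∧-true _ kept
        not-xj , not-yj = ∧-true _ not-moved
    in inj₁ ( xy
            , (λ (x≡j , Ly) → not-∧-true not-xj (⌊⌋-true (x ≟ j) x≡j) Ly)
            , (λ (y≡j , Lx) → not-∧-true not-yj (⌊⌋-true (y ≟ j) y≡j) Lx))
  ... | inj₂ added with ∨-true _ added
  ...   | inj₁ at-x = let x≡i , Ly = ∧-true _ at-x in inj₂ (inj₁ (from-⌊⌋ (x ≟ i) x≡i , Ly))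
  ...   | inj₂ at-y = let y≡i , Lx = ∧-true _ at-y in inj₂ (inj₂ (from-⌊⌋ (y ≟ i) y≡i , Lx))

  π-edge-avoiding-i : ∀ {x y} → x ≢ i → y ≢ i → π i j G x y ≡ true → G x y ≡ true
  π-edge-avoiding-i x≢i y≢i h with π-edge-cases h
  ... | inj₁ (xy , _)         = xy
  ... | inj₂ (inj₁ (x≡i , _)) = contradiction x≡i x≢i
  ... | inj₂ (inj₂ (y≡i , _)) = contradiction y≡i y≢i

  π-neighbour-of-i : ∀ {x} → x ≢ i → π i j G x i ≡ true → G x i ≡ true ⊎ InL x
  π-neighbour-of-i x≢i h with π-edge-cases h
  ... | inj₁ (xi , _)         = inj₁ xi
  ... | inj₂ (inj₁ (x≡i , _)) = contradiction x≡i x≢i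
  ... | inj₂ (inj₂ (_ , Lx))  = inj₂ Lx

  InL⇒¬π-neighbour-of-j : ∀ {x} → i ≢ j → InL x → π i j G x j ≢ true
  InL⇒¬π-neighbour-of-j i≢j Lx h with π-edge-cases h
  ... | inj₁ (_ , _ , not-moved) = not-moved (refl , Lx)
  ... | inj₂ (inj₁ (x≡i , _))    = InL⇒≢i Lx x≡i
  ... | inj₂ (inj₂ (j≡i , _))    = i≢j (sym j≡i)

  IsClique-avoiding-i : ∀ {f : Fin m → Fin n} → IsClique (π i j G) f → i ∉Im f → IsClique G f
  IsClique-avoiding-i (isClique f-inj edges) i∉f =
    isClique f-inj λ u v u≢v → π-edge-avoiding-i (i∉f u) (i∉f v) (edges u v u≢v)

module _ {G : Graph n} (simple : IsSimple G) {i j : Fin n} (i≢j : i ≢ j) where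
  open Shift {G = G} {i} {j}

  clique-beside-moved-vertex :
    ∀ {f : Fin (2 + q) → Fin n} {w} → IsClique (π i j G) f → i ∉Im f →
    (∀ k → π i j G (f k) i ≡ true) → InL (f w) →
    HasClique G (3 + q) ⊎ HasMatching G (4 + q)
  clique-beside-moved-vertex {f = f} {w} f-πclique@(isClique _ πedges) i∉f f~πi Lw
    with any? (λ b → f b ≟ j)
  ... | yes (b , fb≡j) =
    contradiction (subst (λ z → π i j G (f w) z ≡ true) fb≡j
                         (πedges w b (λ w≡b → InL⇒≢j Lw (trans (cong f w≡b) fb≡j))))
                  (InL⇒¬π-neighbour-of-j i≢j Lw)
  ... | no j∈f with all? (λ k → G (f k) j Bool.≟ true)
  ...   | yes f~j = inj₁ (j ∷ f , IsClique-∷ simple f-clique j∉f f~j)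
    where
    f-clique = IsClique-avoiding-i f-πclique i∉f
    j∉f : j ∉Im f
    j∉f k fk≡j = j∈f (k , fk≡j)
  ...   | no ¬f~j =
    let u , uj≢true = ¬∀⟶∃¬ _ _ (λ k → G (f k) j Bool.≟ true) ¬f~j
        ui = [ (λ ui → ui) , (λ Lu → contradiction (InL⇒adjacent-j Lu) uj≢true) ]′
               (π-neighbour-of-i (i∉f u) (f~πi u))
        w≢u = λ w≡u → uj≢true (subst (λ z → G (f z) j ≡ true) w≡u (InL⇒adjacent-j Lw))
    in inj₂ (clique+two-pendant-edges⇒matching simple (IsClique-avoiding-i f-πclique i∉f)
               w≢u (i≢j ∘ sym) (λ k fk≡j → j∈f (k , fk≡j)) i∉f (InL⇒adjacent-j Lw) ui)

  clique-beside-i : ∀ {f : Fin (2 + q) → Fin n} → IsClique (π i j G) f → i ∉Im f →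
                    (∀ k → π i j G (f k) i ≡ true) → HasClique G (3 + q) ⊎ HasMatching G (4 + q)
  clique-beside-i {f = f} f-πclique i∉f f~πi with all? (λ k → G (f k) i Bool.≟ true)
  ... | yes f~i = inj₁ (i ∷ f , IsClique-∷ simple (IsClique-avoiding-i f-πclique i∉f) i∉f f~i)
  ... | no ¬f~i =
    let w , wi≢true = ¬∀⟶∃¬ _ _ (λ k → G (f k) i Bool.≟ true) ¬f~i
        Lw = [ (λ wi → contradiction wi wi≢true) , (λ Lw → Lw) ]′
               (π-neighbour-of-i (i∉f w) (f~πi w))
    in clique-beside-moved-vertex f-πclique i∉f f~πi Lw

  clique-in-shift : ∀ {f : Fin (3 + q) → Fin n} → IsClique (π i j G) f →
                    HasClique G (3 + q) ⊎ HasMatching G (4 + q)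
  clique-in-shift {f = f} f-πclique@(isClique f-inj πedges) with any? (λ a → f a ≟ i)
  ... | no i∈f = inj₁ (f , IsClique-avoiding-i f-πclique (λ k fk≡i → i∈f (k , fk≡i)))
  ... | yes (a , fa≡i) =
    clique-beside-i (IsClique-∘ f-πclique (punchIn-injective a _ _)) i∉rest rest~πi
    where
    i∉rest : i ∉Im (f ∘ punchIn a)
    i∉rest k = subst (f (punchIn a k) ≢_) fa≡i (∉Im-punchIn f-inj a k)
    rest~πi : ∀ k → π i j G (f (punchIn a k)) i ≡ true
    rest~πi k = subst (λ z → π i j G (f (punchIn a k)) z ≡ true) fa≡i
                  (πedges (punchIn a k) a (punchInᵢ≢i a k))

lemma2p4 : (t n : ℕ) → 2 ≤ t → (G : Graph n) → IsSimple G →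
    ¬ (M t ⊆G G) → ¬ (K (2 * t ∸ 1) ⊆G G) →
    (i j : Fin n) → ¬ (i ≡ j) →
    ¬ (K (2 * t ∸ 1) ⊆G π i j G)
lemma2p4 (suc (suc s)) n (s≤s (s≤s _)) G simple no-M no-K i j i≢j K⊆πG =
  [ no-K ∘ HasClique⇒K⊆G _ ∘ subst (HasClique G) (sym clique-size)
  , no-M ∘ HasMatching⇒M⊆G (suc (suc s)) ∘ subst (HasMatching G) (sym matching-size)
  ]′ (clique-in-shift simple i≢j (proj₂ πclique))
  where
  matching-size : 2 * suc (suc s) ≡ 4 + 2 * s
  matching-size = *-distribˡ-+ 2 2 s
  clique-size : 2 * suc (suc s) ∸ 1 ≡ 3 + 2 * s
  clique-size = cong (_∸ 1) matching-size
  πclique : HasClique (π i j G) (3 + 2 * s)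
  πclique = K⊆G⇒HasClique _ (subst (λ p → K p ⊆G π i j G) clique-size K⊆πG)
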